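{- Let $(V,\mathcal B)$ be a symmetric $2$-$(v,k,\lambda)$ design, let $\mathbf b_1,\dots,\mathbf b_k$ be any $k$ blocks of $\mathcal B$, and let $\infty\notin V$ be a new point. Let $\mathcal B'$ be obtained from $\mathcal B$ by adjoining $\infty$ to each of $\mathbf b_1,\dots,\mathbf b_k$. Then the dual $(V\cup\{\infty\},\mathcal B')^\perp$ is a $2$-$(v,k,\lambda)$ adesign.
   Context: A symmetric $2$-$(v,k,\lambda)$ design has $v$ points and $v$ blocks of size $k$, every pair of points lying in exactly $\lambda$ blocks. The dual of an incidence structure $(P,\mathcal C)$ has the blocks of $\mathcal C$ as points, and for each $p\in P$ the block consisting of the members of $\mathcal C$ containing $p$. A $t$-$(v,k,\lambda)$ adesign is an incidence structure with $v$ points and blocks of size $k$ such that every $t$-subset of points lies in exactly $\lambda$ or exactly $\lambda+1$ blocks, both values occurring. -}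

module Defs where

open import Data.Nat using (ℕ; suc; _<_)
open import Data.Bool using (Bool; _∧_)
open import Data.Fin using (Fin; zero; suc)
open import Data.Fin.Subset using (Subset; ∣_∣)
open import Data.Vec using (tabulate; lookup)
open import Data.Product using (_×_; Σ; ∃₂)
open import Data.Sum using (_⊎_)
open import Relation.Binary.PropositionalEquality using (_≡_; _≢_)

-- An incidence structure with points Fin n and an indexed family of
-- b blocks (Fin b), given by its incidence matrix:
-- Inc p j = true  iff  point p lies in block j.
Incidence : ℕ → ℕ → Set
Incidence n b = Fin n → Fin b → Bool

count : ∀ {m} → (Fin m → Bool) → ℕ
count f = ∣ tabulate f ∣

blockSize : ∀ {n b} → Incidence n b → Fin b → ℕ
blockSize I j = count (λ p → I p j)

pairCount : ∀ {n b} → Incidence n b → Fin n → Fin n → ℕ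
pairCount I x y = count (λ j → I x j ∧ I y j)

IsSymmetricDesign : (v k lam : ℕ) → Incidence v v → Set
IsSymmetricDesign v k lam I =
  (∀ j → blockSize I j ≡ k) × (∀ x y → x ≢ y → pairCount I x y ≡ lam)

IsAdesign2 : ∀ {b} (v k lam : ℕ) → Incidence v b → Set
IsAdesign2 v k lam I =
  (∀ j → blockSize I j ≡ k)
  × (∀ x y → x ≢ y → (pairCount I x y ≡ lam) ⊎ (pairCount I x y ≡ suc lam))
  × (∃₂ λ x y → x ≢ y × pairCount I x y ≡ lam)
  × (∃₂ λ x y → x ≢ y × pairCount I x y ≡ suc lam)

dual : ∀ {n b} → Incidence n b → Incidence b n
dual I j p = I p j

-- adjoin a new point ∞ (represented by zero; old point p becomes suc p)
-- to exactly the blocks in the subset S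
adjoinInfinity : ∀ {n b} → Incidence n b → Subset b → Incidence (suc n) b
adjoinInfinity I S zero    j = lookup S j
adjoinInfinity I S (suc p) j = I p j

-- Counting flags shows that in a symmetric 2-(v,k,λ) design every point
-- lies on k blocks and k(k − 1) = λ(v − 1).  Fix a block B and let
-- X(B′) = |B ∩ B′|; the identity NNᵀ = (k − λ)I + λJ for the incidence
-- matrix N gives the first two moments of X over the v − 1 blocks B′ ≠ B,
-- namely mean λ and mean square λ², so X is constantly λ: the dual is again
-- a symmetric 2-(v,k,λ) design.  In the dual of the extended structure two
-- blocks B, B′ share the old λ points, plus ∞ exactly when both lie in S;
-- since 2 ≤ |S| < v both counts λ and λ + 1 occur.
module Submission where

open import Defs
open import Data.Bool using (Bool; true; false; _∧_)
open import Data.Fin using (Fin; zero; suc; punchIn; punchOut)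
open import Data.Fin.Properties using (suc-injective; punchInᵢ≢i; punchIn-punchOut)
open import Data.Fin.Subset using (Subset; ∣_∣)
open import Data.Nat using (ℕ; zero; suc; _+_; _*_; _≤_; _<_; s≤s; z<s; s≤s⁻¹; ∣_-_∣)
open import Data.Nat.Properties hiding (suc-injective)
open import Data.Nat.Tactic.RingSolver using (solve-∀)
open import Data.Product using (∃; ∃₂; _×_; _,_; proj₁; proj₂)
open import Data.Sum using (_⊎_; inj₁; inj₂; reduce)
open import Data.Vec using (lookup)
open import Data.Vec.Properties using (tabulate∘lookup)
open import Function using (_∘_)
open import Relation.Binary.PropositionalEquality
open import Algebra.Properties.CommutativeSemigroup *-commutativeSemigroup using (interchange)
open import Algebra.Properties.Semiring.Sum +-*-semiring
  using (sum; sum-syntax; sum-cong-≗; sum-remove; ∑-distrib-+; ∑-comm; *-distribˡ-sum; *-distribʳ-sum)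

open ≡-Reasoning

⟦_⟧ : Bool → ℕ
⟦ true ⟧  = 1
⟦ false ⟧ = 0

⟦∧⟧ : ∀ a b → ⟦ a ∧ b ⟧ ≡ ⟦ a ⟧ * ⟦ b ⟧
⟦∧⟧ true  true  = refl
⟦∧⟧ true  false = refl
⟦∧⟧ false _     = refl

⟦⟧-idem : ∀ a → ⟦ a ⟧ * ⟦ a ⟧ ≡ ⟦ a ⟧
⟦⟧-idem true  = refl
⟦⟧-idem false = refl

count-suc : ∀ {n} (f : Fin (suc n) → Bool) → count f ≡ ⟦ f zero ⟧ + count (f ∘ suc)
count-suc f with f zero
... | true  = refl
... | false = refl

count≡∑ : ∀ {n} (f : Fin n → Bool) → count f ≡ ∑[ i < n ] ⟦ f i ⟧
count≡∑ {zero}  f = refl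
count≡∑ {suc n} f = trans (count-suc f) (cong (⟦ f zero ⟧ +_) (count≡∑ (f ∘ suc)))

0<count⇒∃true : ∀ {n} (f : Fin n → Bool) → 0 < count f → ∃ λ i → f i ≡ true
0<count⇒∃true {zero}  f ()
0<count⇒∃true {suc n} f 0<c with f zero in eq | subst (0 <_) (count-suc f) 0<c
... | true  | _    = zero , eq
... | false | 0<c′ = let i , fi = 0<count⇒∃true (f ∘ suc) 0<c′ in suc i , fi

count<n⇒∃false : ∀ {n} (f : Fin n → Bool) → count f < n → ∃ λ i → f i ≡ false
count<n⇒∃false {zero}  f ()
count<n⇒∃false {suc n} f c<n with f zero in eq | subst (_< suc n) (count-suc f) c<n
... | true  | c<n′ = let i , fi = count<n⇒∃false (f ∘ suc) (s≤s⁻¹ c<n′) in suc i , fi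
... | false | _    = zero , eq

1<count⇒∃₂true : ∀ {n} (f : Fin n → Bool) → 1 < count f →
                 ∃₂ λ i j → i ≢ j × f i ≡ true × f j ≡ true
1<count⇒∃₂true {zero}  f ()
1<count⇒∃₂true {suc n} f 1<c with f zero in eq | subst (1 <_) (count-suc f) 1<c
... | true  | 1<c′ =
  let j , fj = 0<count⇒∃true (f ∘ suc) (s≤s⁻¹ 1<c′) in zero , suc j , (λ ()) , eq , fj
... | false | 1<c′ =
  let i , j , i≢j , fi , fj = 1<count⇒∃₂true (f ∘ suc) 1<c′
  in  suc i , suc j , i≢j ∘ suc-injective , fi , fj

∑-const : ∀ n c → ∑[ i < n ] c ≡ n * c
∑-const zero    c = refl
∑-const (suc n) c = cong (c +_) (∑-const n c)

∑-mono-≤ : ∀ {n} {f g : Fin n → ℕ} → (∀ i → f i ≤ g i) → sum f ≤ sum g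
∑-mono-≤ {zero}  f≤g = ≤-refl
∑-mono-≤ {suc n} f≤g = +-mono-≤ (f≤g zero) (∑-mono-≤ (f≤g ∘ suc))

m≤o∧n≤p∧m+n≡o+p⇒m≡o : ∀ {m n o p} → m ≤ o → n ≤ p → m + n ≡ o + p → m ≡ o
m≤o∧n≤p∧m+n≡o+p⇒m≡o {m} {n} {o} m≤o n≤p eq =
  ≤-antisym m≤o (+-cancelʳ-≤ n o m (≤-trans (+-monoʳ-≤ o n≤p) (≤-reflexive (sym eq))))

f≤g∧∑f≡∑g⇒f≗g : ∀ {n} {f g : Fin n → ℕ} → (∀ i → f i ≤ g i) → sum f ≡ sum g → f ≗ g
f≤g∧∑f≡∑g⇒f≗g {suc n} {f} {g} f≤g ∑f≡∑g = pointwise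
  where
  f₀≡g₀ : f zero ≡ g zero
  f₀≡g₀ = m≤o∧n≤p∧m+n≡o+p⇒m≡o (f≤g zero) (∑-mono-≤ (f≤g ∘ suc)) ∑f≡∑g

  pointwise : f ≗ g
  pointwise zero    = f₀≡g₀
  pointwise (suc i) = f≤g∧∑f≡∑g⇒f≗g (f≤g ∘ suc)
    (+-cancelˡ-≡ (f zero) _ _ (trans ∑f≡∑g (cong (_+ sum (g ∘ suc)) (sym f₀≡g₀)))) i

∑-product : ∀ {m n} (f : Fin m → ℕ) (g : Fin n → ℕ) →
            sum f * sum g ≡ ∑[ p < m ] ∑[ q < n ] (f p * g q)
∑-product f g = trans (*-distribʳ-sum (sum g) f) (sum-cong-≗ (λ p → *-distribˡ-sum (f p) g))

∑-square : ∀ {m n} (u : Fin m → Fin n → ℕ) →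
           ∑[ j < n ] ((∑[ p < m ] u p j) * (∑[ q < m ] u q j))
             ≡ ∑[ p < m ] ∑[ q < m ] ∑[ j < n ] (u p j * u q j)
∑-square {m} {n} u = begin
  ∑[ j < n ] ((∑[ p < m ] u p j) * (∑[ q < m ] u q j))
    ≡⟨ sum-cong-≗ (λ j → ∑-product (λ p → u p j) (λ q → u q j)) ⟩
  ∑[ j < n ] ∑[ p < m ] ∑[ q < m ] (u p j * u q j)
    ≡⟨ ∑-comm (λ j p → ∑[ q < m ] (u p j * u q j)) ⟩
  ∑[ p < m ] ∑[ j < n ] ∑[ q < m ] (u p j * u q j)
    ≡⟨ sum-cong-≗ (λ p → ∑-comm (λ j q → u p j * u q j)) ⟩
  ∑[ p < m ] ∑[ q < m ] ∑[ j < n ] (u p j * u q j)   ∎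

∑-exchangeAt : ∀ {n} (f g : Fin (suc n) → ℕ) x → (∀ i → i ≢ x → f i ≡ g i) →
               sum f + g x ≡ f x + sum g
∑-exchangeAt f g x f≡g = begin
  sum f + g x                              ≡⟨ cong (_+ g x) (sum-remove {i = x} f) ⟩
  f x + sum (f ∘ punchIn x) + g x          ≡⟨ cong (λ s → f x + s + g x) (sum-cong-≗ off-x) ⟩
  f x + sum (g ∘ punchIn x) + g x          ≡⟨ +-assoc (f x) _ (g x) ⟩
  f x + (sum (g ∘ punchIn x) + g x)        ≡⟨ cong (f x +_) (+-comm _ (g x)) ⟩
  f x + (g x + sum (g ∘ punchIn x))        ≡⟨ cong (f x +_) (sum-remove {i = x} g) ⟨
  f x + sum g                              ∎
  where
  off-x : ∀ i → f (punchIn x i) ≡ g (punchIn x i)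
  off-x i = f≡g (punchIn x i) (punchInᵢ≢i x i)

x²+y²≡2xy+∣x-y∣² : ∀ x y → x * x + y * y ≡ (x * y + x * y) + ∣ x - y ∣ * ∣ x - y ∣
x²+y²≡2xy+∣x-y∣² zero    y       = refl
x²+y²≡2xy+∣x-y∣² (suc x) zero    = shape x
  where
  shape : ∀ x → suc x * suc x + 0 ≡ (suc x * 0 + suc x * 0) + suc x * suc x
  shape = solve-∀
x²+y²≡2xy+∣x-y∣² (suc x) (suc y) = begin
  suc x * suc x + suc y * suc y              ≡⟨ expandˡ x y ⟩
  (x * x + y * y) + 2 * (1 + x + y)          ≡⟨ cong (_+ 2 * (1 + x + y)) (x²+y²≡2xy+∣x-y∣² x y) ⟩
  (x * y + x * y + d * d) + 2 * (1 + x + y)  ≡⟨ expandʳ x y d ⟩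
  (suc x * suc y + suc x * suc y) + d * d    ∎
  where
  d = ∣ x - y ∣
  expandˡ : ∀ x y → suc x * suc x + suc y * suc y ≡ (x * x + y * y) + 2 * (1 + x + y)
  expandˡ = solve-∀
  expandʳ : ∀ x y d → (x * y + x * y + d * d) + 2 * (1 + x + y)
                      ≡ (suc x * suc y + suc x * suc y) + d * d
  expandʳ = solve-∀

2xy≤x²+y² : ∀ x y → x * y + x * y ≤ x * x + y * y
2xy≤x²+y² x y = ≤-trans (m≤m+n _ _) (≤-reflexive (sym (x²+y²≡2xy+∣x-y∣² x y)))

x²+y²≡2xy⇒x≡y : ∀ x y → x * x + y * y ≡ x * y + x * y → x ≡ y
x²+y²≡2xy⇒x≡y x y eq = ∣m-n∣≡0⇒m≡n (reduce (m*n≡0⇒m≡0∨n≡0 ∣ x - y ∣ d²≡0))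
  where
  d²≡0 : ∣ x - y ∣ * ∣ x - y ∣ ≡ 0
  d²≡0 = +-cancelˡ-≡ (x * y + x * y) _ 0
           (trans (sym (x²+y²≡2xy+∣x-y∣² x y)) (trans eq (sym (+-identityʳ _))))

-- Equality in Σ (fᵢ − c)² ≥ 0, phrased without subtraction.
moments⇒constant : ∀ {n} (f : Fin n → ℕ) c →
                   sum f ≡ n * c → ∑[ i < n ] (f i * f i) ≡ n * (c * c) → ∀ i → f i ≡ c
moments⇒constant {n} f c ∑f ∑f² i =
  x²+y²≡2xy⇒x≡y (f i) c (sym (f≤g∧∑f≡∑g⇒f≗g (λ i → 2xy≤x²+y² (f i) c) sums-agree i))
  where
  sums-agree : ∑[ i < n ] (f i * c + f i * c) ≡ ∑[ i < n ] (f i * f i + c * c)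
  sums-agree = begin
    ∑[ i < n ] (f i * c + f i * c)
      ≡⟨ ∑-distrib-+ fc fc ⟩
    sum fc + sum fc
      ≡⟨ cong (λ s → s + s) (*-distribʳ-sum c f) ⟨
    sum f * c + sum f * c
      ≡⟨ cong (λ s → s * c + s * c) ∑f ⟩
    n * c * c + n * c * c
      ≡⟨ cong (λ s → s + s) (*-assoc n c c) ⟩
    n * (c * c) + n * (c * c)
      ≡⟨ cong₂ _+_ ∑f² (∑-const n (c * c)) ⟨
    ∑[ i < n ] (f i * f i) + ∑[ i < n ] (c * c)
      ≡⟨ ∑-distrib-+ (λ i → f i * f i) (λ _ → c * c) ⟨
    ∑[ i < n ] (f i * f i + c * c) ∎
    where
    fc : Fin n → ℕ
    fc i = f i * c

blockSize≡∑ : ∀ {v b} (I : Incidence v b) j → blockSize I j ≡ ∑[ p < v ] ⟦ I p j ⟧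
blockSize≡∑ I j = count≡∑ (λ p → I p j)

pairCount≡∑ : ∀ {v b} (I : Incidence v b) x y →
              pairCount I x y ≡ ∑[ j < b ] (⟦ I x j ⟧ * ⟦ I y j ⟧)
pairCount≡∑ I x y = trans (count≡∑ (λ j → I x j ∧ I y j)) (sum-cong-≗ (λ j → ⟦∧⟧ (I x j) (I y j)))

pairCount-self : ∀ {v b} (I : Incidence v b) x → pairCount I x x ≡ blockSize (dual I) x
pairCount-self I x =
  trans (pairCount≡∑ I x x) (trans (sum-cong-≗ (λ j → ⟦⟧-idem (I x j))) (sym (blockSize≡∑ (dual I) x)))

∑-replication≡∑-blockSize : ∀ {v b} (I : Incidence v b) →
                            ∑[ p < v ] blockSize (dual I) p ≡ ∑[ j < b ] blockSize I j
∑-replication≡∑-blockSize I = begin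
  ∑[ p < _ ] blockSize (dual I) p      ≡⟨ sum-cong-≗ (blockSize≡∑ (dual I)) ⟩
  ∑[ p < _ ] ∑[ j < _ ] ⟦ I p j ⟧      ≡⟨ ∑-comm (λ p j → ⟦ I p j ⟧) ⟩
  ∑[ j < _ ] ∑[ p < _ ] ⟦ I p j ⟧      ≡⟨ sum-cong-≗ (blockSize≡∑ I) ⟨
  ∑[ j < _ ] blockSize I j             ∎

replication-equation : ∀ {v b k lam} (I : Incidence (suc v) b) → (∀ j → blockSize I j ≡ k) →
                       (∀ x y → x ≢ y → pairCount I x y ≡ lam) →
                       ∀ x → blockSize (dual I) x * k ≡ blockSize (dual I) x + v * lam
replication-equation {v} {b} {k} {lam} I blocks pairs x = begin
  blockSize (dual I) x * k
    ≡⟨ cong (_* k) (blockSize≡∑ (dual I) x) ⟩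
  (∑[ j < b ] ⟦ I x j ⟧) * k
    ≡⟨ *-distribʳ-sum k (λ j → ⟦ I x j ⟧) ⟩
  ∑[ j < b ] (⟦ I x j ⟧ * k)
    ≡⟨ sum-cong-≗ (λ j → cong (⟦ I x j ⟧ *_) (k≡∑ j)) ⟩
  ∑[ j < b ] (⟦ I x j ⟧ * ∑[ y < suc v ] ⟦ I y j ⟧)
    ≡⟨ sum-cong-≗ (λ j → *-distribˡ-sum ⟦ I x j ⟧ (λ y → ⟦ I y j ⟧)) ⟩
  ∑[ j < b ] ∑[ y < suc v ] (⟦ I x j ⟧ * ⟦ I y j ⟧)
    ≡⟨ ∑-comm (λ j y → ⟦ I x j ⟧ * ⟦ I y j ⟧) ⟩
  ∑[ y < suc v ] ∑[ j < b ] (⟦ I x j ⟧ * ⟦ I y j ⟧)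
    ≡⟨ sum-cong-≗ (pairCount≡∑ I x) ⟨
  ∑[ y < suc v ] pairCount I x y
    ≡⟨ sum-remove {i = x} (pairCount I x) ⟩
  pairCount I x x + ∑[ i < v ] pairCount I x (punchIn x i)
    ≡⟨ cong₂ _+_ (pairCount-self I x) (trans (sum-cong-≗ off-diagonal) (∑-const v lam)) ⟩
  blockSize (dual I) x + v * lam ∎
  where
  k≡∑ : ∀ j → k ≡ ∑[ y < suc v ] ⟦ I y j ⟧
  k≡∑ j = trans (sym (blocks j)) (blockSize≡∑ I j)
  off-diagonal : ∀ i → pairCount I x (punchIn x i) ≡ lam
  off-diagonal i = pairs x (punchIn x i) (punchInᵢ≢i x i ∘ sym)

symmetric⇒replication≡k : ∀ {v k lam} {I : Incidence v v} → 1 < k → IsSymmetricDesign v k lam I →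
                          ∀ p → blockSize (dual I) p ≡ k
symmetric⇒replication≡k {suc v} {suc zero} (s≤s ()) _
symmetric⇒replication≡k {suc v} {suc (suc k)} {lam} {I} _ (blocks , pairs) p = trans (r≡r₀ p) r₀≡k
  where
  r : Fin (suc v) → ℕ
  r = blockSize (dual I)

  r*k≡v*λ : ∀ p → r p * suc k ≡ v * lam
  r*k≡v*λ p = +-cancelˡ-≡ (r p) _ _
    (trans (sym (*-suc (r p) (suc k))) (replication-equation I blocks pairs p))

  r≡r₀ : ∀ p → r p ≡ r zero
  r≡r₀ p = *-cancelʳ-≡ _ _ (suc k) (trans (r*k≡v*λ p) (sym (r*k≡v*λ zero)))

  r₀≡k : r zero ≡ suc (suc k)
  r₀≡k = *-cancelˡ-≡ _ _ (suc v) (begin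
    suc v * r zero                      ≡⟨ ∑-const (suc v) (r zero) ⟨
    ∑[ p < suc v ] r zero               ≡⟨ sum-cong-≗ r≡r₀ ⟨
    ∑[ p < suc v ] r p                  ≡⟨ ∑-replication≡∑-blockSize I ⟩
    ∑[ j < suc v ] blockSize I j        ≡⟨ sum-cong-≗ blocks ⟩
    ∑[ j < suc v ] suc (suc k)          ≡⟨ ∑-const (suc v) (suc (suc k)) ⟩
    suc v * suc (suc k)                 ∎)

_ᵀ·_ : ∀ {v b} → Incidence v b → (Fin v → ℕ) → Fin b → ℕ
(I ᵀ· a) j = ∑[ p < _ ] (a p * ⟦ I p j ⟧)

∑-ᵀ· : ∀ {v b k} (I : Incidence v b) → (∀ p → blockSize (dual I) p ≡ k) →
       ∀ a → sum (I ᵀ· a) ≡ sum a * k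
∑-ᵀ· {v} {b} {k} I replication a = begin
  ∑[ j < b ] ∑[ p < v ] (a p * ⟦ I p j ⟧)
    ≡⟨ ∑-comm (λ j p → a p * ⟦ I p j ⟧) ⟩
  ∑[ p < v ] ∑[ j < b ] (a p * ⟦ I p j ⟧)
    ≡⟨ sum-cong-≗ (λ p → *-distribˡ-sum (a p) (λ j → ⟦ I p j ⟧)) ⟨
  ∑[ p < v ] (a p * ∑[ j < b ] ⟦ I p j ⟧)
    ≡⟨ sum-cong-≗ (λ p → cong (a p *_) (r≡k p)) ⟩
  ∑[ p < v ] (a p * k)
    ≡⟨ *-distribʳ-sum k a ⟨
  sum a * k ∎
  where
  r≡k : ∀ p → ∑[ j < b ] ⟦ I p j ⟧ ≡ k
  r≡k p = trans (sym (blockSize≡∑ (dual I) p)) (replication p)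

-- The quadratic form of NNᵀ = (k − λ)·Id + λ·J.
∑-ᵀ·² : ∀ {v b k lam} (I : Incidence (suc v) b) → (∀ p → blockSize (dual I) p ≡ k) →
        (∀ x y → x ≢ y → pairCount I x y ≡ lam) → ∀ a →
        ∑[ j < b ] ((I ᵀ· a) j * (I ᵀ· a) j) + sum (λ p → a p * a p) * lam
          ≡ sum (λ p → a p * a p) * k + sum a * sum a * lam
∑-ᵀ·² {v} {b} {k} {lam} I replication pairs a = begin
  ∑[ j < b ] ((I ᵀ· a) j * (I ᵀ· a) j) + sum a² * lam
    ≡⟨ cong₂ _+_ (trans (∑-square (λ p j → a p * ⟦ I p j ⟧)) (sum-cong-≗ (sum-cong-≗ ∘ gram)))
                 (*-distribʳ-sum lam a²) ⟩
  ∑[ p < suc v ] ∑[ q < suc v ] (a p * a q * pairCount I p q) + ∑[ p < suc v ] (a p * a p * lam)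
    ≡⟨ ∑-distrib-+ (λ p → ∑[ q < suc v ] (a p * a q * pairCount I p q)) (λ p → a p * a p * lam) ⟨
  ∑[ p < suc v ] (∑[ q < suc v ] (a p * a q * pairCount I p q) + a p * a p * lam)
    ≡⟨ sum-cong-≗ row ⟩
  ∑[ p < suc v ] (a p * a p * k + ∑[ q < suc v ] (a p * a q * lam))
    ≡⟨ ∑-distrib-+ (λ p → a p * a p * k) (λ p → ∑[ q < suc v ] (a p * a q * lam)) ⟩
  ∑[ p < suc v ] (a p * a p * k) + ∑[ p < suc v ] ∑[ q < suc v ] (a p * a q * lam)
    ≡⟨ cong₂ _+_ (*-distribʳ-sum k a²) ∑∑a*a*λ ⟨
  sum a² * k + sum a * sum a * lam ∎
  where
  a² : Fin (suc v) → ℕ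
  a² p = a p * a p

  gram : ∀ p q → ∑[ j < b ] ((a p * ⟦ I p j ⟧) * (a q * ⟦ I q j ⟧)) ≡ a p * a q * pairCount I p q
  gram p q = begin
    ∑[ j < b ] ((a p * ⟦ I p j ⟧) * (a q * ⟦ I q j ⟧))
      ≡⟨ sum-cong-≗ (λ j → interchange (a p) ⟦ I p j ⟧ (a q) ⟦ I q j ⟧) ⟩
    ∑[ j < b ] (a p * a q * (⟦ I p j ⟧ * ⟦ I q j ⟧))
      ≡⟨ *-distribˡ-sum (a p * a q) (λ j → ⟦ I p j ⟧ * ⟦ I q j ⟧) ⟨
    a p * a q * ∑[ j < b ] (⟦ I p j ⟧ * ⟦ I q j ⟧)
      ≡⟨ cong (a p * a q *_) (pairCount≡∑ I p q) ⟨
    a p * a q * pairCount I p q ∎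

  row : ∀ p → ∑[ q < suc v ] (a p * a q * pairCount I p q) + a p * a p * lam
            ≡ a p * a p * k + ∑[ q < suc v ] (a p * a q * lam)
  row p = trans (∑-exchangeAt (λ q → a p * a q * pairCount I p q) (λ q → a p * a q * lam) p
                  (λ q q≢p → cong (a p * a q *_) (pairs p q (q≢p ∘ sym))))
                (cong (λ s → a p * a p * s + _) (trans (pairCount-self I p) (replication p)))

  ∑∑a*a*λ : sum a * sum a * lam ≡ ∑[ p < suc v ] ∑[ q < suc v ] (a p * a q * lam)
  ∑∑a*a*λ = begin
    sum a * sum a * lam
      ≡⟨ cong (_* lam) (∑-product a a) ⟩
    (∑[ p < suc v ] ∑[ q < suc v ] (a p * a q)) * lam
      ≡⟨ *-distribʳ-sum lam (λ p → ∑[ q < suc v ] (a p * a q)) ⟩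
    ∑[ p < suc v ] ((∑[ q < suc v ] (a p * a q)) * lam)
      ≡⟨ sum-cong-≗ (λ p → *-distribʳ-sum lam (λ q → a p * a q)) ⟩
    ∑[ p < suc v ] ∑[ q < suc v ] (a p * a q * lam) ∎

symmetric⇒intersection≡λ : ∀ {v k lam} {I : Incidence v v} → 1 < k → IsSymmetricDesign v k lam I →
                           ∀ j j′ → j ≢ j′ → pairCount (dual I) j j′ ≡ lam
symmetric⇒intersection≡λ {suc v} {k} {lam} {I} 1<k design@(blocks , pairs) j j′ j≢j′ = begin
  pairCount (dual I) j j′
    ≡⟨ pairCount≡∑ (dual I) j j′ ⟩
  X j′
    ≡⟨ cong X (punchIn-punchOut j≢j′) ⟨
  X (punchIn j (punchOut j≢j′))
    ≡⟨ moments⇒constant (X ∘ punchIn j) lam mean meanSquare (punchOut j≢j′) ⟩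
  lam ∎
  where
  replication : ∀ p → blockSize (dual I) p ≡ k
  replication = symmetric⇒replication≡k {I = I} 1<k design

  a X : Fin (suc v) → ℕ
  a p = ⟦ I p j ⟧
  X = I ᵀ· a

  ∑a≡k : sum a ≡ k
  ∑a≡k = trans (sym (blockSize≡∑ I j)) (blocks j)

  Xj≡k : X j ≡ k
  Xj≡k = trans (sum-cong-≗ (λ p → ⟦⟧-idem (I p j))) ∑a≡k

  k*k≡k+v*λ : k * k ≡ k + v * lam
  k*k≡k+v*λ = subst (λ r → r * k ≡ r + v * lam) (replication zero)
    (replication-equation I blocks pairs zero)

  mean : sum (X ∘ punchIn j) ≡ v * lam
  mean = +-cancelˡ-≡ k _ _ (begin
    k + sum (X ∘ punchIn j)     ≡⟨ cong (_+ sum (X ∘ punchIn j)) Xj≡k ⟨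
    X j + sum (X ∘ punchIn j)   ≡⟨ sum-remove {i = j} X ⟨
    sum X                       ≡⟨ ∑-ᵀ· I replication a ⟩
    sum a * k                   ≡⟨ cong (_* k) ∑a≡k ⟩
    k * k                       ≡⟨ k*k≡k+v*λ ⟩
    k + v * lam                 ∎)

  X² : Fin (suc v) → ℕ
  X² j′ = X j′ * X j′

  meanSquare : sum (X² ∘ punchIn j) ≡ v * (lam * lam)
  meanSquare = +-cancelʳ-≡ (k * lam) _ _ (+-cancelˡ-≡ (k * k) _ _ (begin
    k * k + (sum (X² ∘ punchIn j) + k * lam)
      ≡⟨ +-assoc (k * k) _ _ ⟨
    k * k + sum (X² ∘ punchIn j) + k * lam
      ≡⟨ cong (λ s → s + sum (X² ∘ punchIn j) + k * lam) (cong₂ _*_ Xj≡k Xj≡k) ⟨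
    X j * X j + sum (X² ∘ punchIn j) + k * lam
      ≡⟨ cong (_+ k * lam) (sum-remove {i = j} X²) ⟨
    sum X² + k * lam
      ≡⟨ cong (λ s → sum X² + s * lam) Xj≡k ⟨
    sum X² + X j * lam
      ≡⟨ ∑-ᵀ·² I replication pairs a ⟩
    X j * k + sum a * sum a * lam
      ≡⟨ cong₂ (λ s t → s * k + t * t * lam) Xj≡k ∑a≡k ⟩
    k * k + k * k * lam
      ≡⟨ cong (λ s → k * k + s * lam) k*k≡k+v*λ ⟩
    k * k + (k + v * lam) * lam
      ≡⟨ cong (k * k +_) (expand k v lam) ⟩
    k * k + (v * (lam * lam) + k * lam) ∎))
    where
    expand : ∀ k v lam → (k + v * lam) * lam ≡ v * (lam * lam) + k * lam
    expand = solve-∀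

dual-isSymmetricDesign : ∀ {v k lam} {I : Incidence v v} → 1 < k → IsSymmetricDesign v k lam I →
                         IsSymmetricDesign v k lam (dual I)
dual-isSymmetricDesign 1<k design =
  symmetric⇒replication≡k 1<k design , symmetric⇒intersection≡λ 1<k design

blockSize-dual-adjoinInfinity-∞ : ∀ {n b} (I : Incidence n b) S →
                                  blockSize (dual (adjoinInfinity I S)) zero ≡ ∣ S ∣
blockSize-dual-adjoinInfinity-∞ I S = cong ∣_∣ (tabulate∘lookup S)

pairCount-dual-adjoinInfinity : ∀ {n b} (I : Incidence n b) S x y →
                                pairCount (dual (adjoinInfinity I S)) x y
                                  ≡ ⟦ lookup S x ∧ lookup S y ⟧ + pairCount (dual I) x y
pairCount-dual-adjoinInfinity I S x y =
  count-suc (λ p → adjoinInfinity I S p x ∧ adjoinInfinity I S p y)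

pairCount≡λ+[∧]⇒isAdesign2 : ∀ {v b k lam} (J : Incidence v b) (T : Fin v → Bool) →
                             1 < count T → count T < v → (∀ j → blockSize J j ≡ k) →
                             (∀ x y → x ≢ y → pairCount J x y ≡ ⟦ T x ∧ T y ⟧ + lam) →
                             IsAdesign2 v k lam J
pairCount≡λ+[∧]⇒isAdesign2 {lam = lam} J T 1<∣T∣ ∣T∣<v blocks pairs =
  blocks , λ-or-suc-λ , λ-attained , suc-λ-attained
  where
  λ-or-suc-λ : ∀ x y → x ≢ y → (pairCount J x y ≡ lam) ⊎ (pairCount J x y ≡ suc lam)
  λ-or-suc-λ x y x≢y with T x ∧ T y | pairs x y x≢y
  ... | true  | eq = inj₂ eq
  ... | false | eq = inj₁ eq

  λ-attained : ∃₂ λ x y → x ≢ y × pairCount J x y ≡ lam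
  λ-attained with 0<count⇒∃true T (<-trans z<s 1<∣T∣) | count<n⇒∃false T ∣T∣<v
  ... | x , Tx | y , Ty =
    x , y , x≢y , trans (pairs x y x≢y) (cong₂ (λ s t → ⟦ s ∧ t ⟧ + lam) Tx Ty)
    where
    x≢y : x ≢ y
    x≢y refl with trans (sym Tx) Ty
    ... | ()

  suc-λ-attained : ∃₂ λ x y → x ≢ y × pairCount J x y ≡ suc lam
  suc-λ-attained with 1<count⇒∃₂true T 1<∣T∣
  ... | x , y , x≢y , Tx , Ty =
    x , y , x≢y , trans (pairs x y x≢y) (cong₂ (λ s t → ⟦ s ∧ t ⟧ + lam) Tx Ty)

lemma8 : (v k lam : ℕ) (I : Incidence v v) → 1 < k → k < v →
    IsSymmetricDesign v k lam I →
    (S : Subset v) → ∣ S ∣ ≡ k →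
    IsAdesign2 v k lam (dual (adjoinInfinity I S))
lemma8 v k lam I 1<k k<v design S ∣S∣≡k =
  pairCount≡λ+[∧]⇒isAdesign2 D (lookup S)
    (subst (1 <_) (sym count-S) 1<k) (subst (_< v) (sym count-S) k<v) blockSizes pairCounts
  where
  D : Incidence v (suc v)
  D = dual (adjoinInfinity I S)

  dual-design : IsSymmetricDesign v k lam (dual I)
  dual-design = dual-isSymmetricDesign 1<k design

  count-S : count (lookup S) ≡ k
  count-S = trans (blockSize-dual-adjoinInfinity-∞ I S) ∣S∣≡k

  blockSizes : ∀ p → blockSize D p ≡ k
  blockSizes zero    = count-S
  blockSizes (suc p) = proj₁ dual-design p

  pairCounts : ∀ x y → x ≢ y → pairCount D x y ≡ ⟦ lookup S x ∧ lookup S y ⟧ + lam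
  pairCounts x y x≢y =
    trans (pairCount-dual-adjoinInfinity I S x y) (cong (_ +_) (proj₂ dual-design x y x≢y))
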